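{- Let $\varphi$ be the linear operator on $\mathbb K[x]$ with $\varphi x^n=(x)_n=x(x-1)\cdots(x-n+1)$, so that $\varphi^{ -1}x^n=\sum_{k=0}^n\left\{{n\atop k}\right\}x^k$. Then for every $n\in\mathbb N$, \[ \varphi^{ -1}\hat x^n=\sum_{k=0}^n\left\{{n\atop k}\right\}\hat x^k\varphi^{ -1}E^k. \]
   Context: $\mathbb K$ is a field of characteristic zero; $\hat x$ is multiplication by $x$ and $E$ is the shift $f(x)\mapsto f(x+1)$, so $E^k f(x)=f(x+k)$. $\left\{{n\atop k}\right\}$ denotes the Stirling numbers of the second kind. -}

module Defs where

open import Level using (Level; _⊔_)
open import Data.Nat using (ℕ; zero; suc)
open import Data.List using (List; []; _∷_; map)
open import Relation.Nullary using (¬_)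
open import Data.Product using (Σ)
open import Algebra.Bundles using (CommutativeRing)
import Algebra.Definitions.RawMonoid as RawMonoidDefs

record CharZeroField (c ℓ : Level) : Set (Level.suc (c ⊔ ℓ)) where
  field
    ring : CommutativeRing c ℓ
  open CommutativeRing ring
  open RawMonoidDefs +-rawMonoid using (_×_)
  field
    1≉0       : ¬ (1# ≈ 0#)
    inverse   : ∀ x → ¬ (x ≈ 0#) → Σ Carrier (λ y → x * y ≈ 1#)
    charZero  : ∀ n → ¬ (suc n × 1# ≈ 0#)

S₂ : ℕ → ℕ → ℕ
S₂ zero    zero    = 1
S₂ zero    (suc k) = 0
S₂ (suc n) zero    = 0
S₂ (suc n) (suc k) = suc k Data.Nat.* S₂ n (suc k) Data.Nat.+ S₂ n k

-- Polynomials over a commutative ring, as coefficient lists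
-- (constant term first), compared coefficientwise (trailing zeros ignored).
module Polynomials {c ℓ} (R : CommutativeRing c ℓ) where
  open CommutativeRing R
  open RawMonoidDefs +-rawMonoid using (_×_)

  Poly : Set c
  Poly = List Carrier

  coeff : Poly → ℕ → Carrier
  coeff []      _       = 0#
  coeff (a ∷ p) zero    = a
  coeff (a ∷ p) (suc i) = coeff p i

  infix 4 _≈ₚ_
  _≈ₚ_ : Poly → Poly → Set ℓ
  p ≈ₚ q = ∀ i → coeff p i ≈ coeff q i

  infixl 6 _+ₚ_
  _+ₚ_ : Poly → Poly → Poly
  []      +ₚ q       = q
  (a ∷ p) +ₚ []      = a ∷ p
  (a ∷ p) +ₚ (b ∷ q) = (a + b) ∷ (p +ₚ q)

  _·ₚ_ : Carrier → Poly → Poly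
  a ·ₚ p = map (a *_) p

  x̂ : Poly → Poly
  x̂ p = 0# ∷ p

  -- E : f(x) ↦ f(x+1)   (Horner: E(a + x q) = a + (x+1) E q)
  E : Poly → Poly
  E []      = []
  E (a ∷ p) = (a ∷ []) +ₚ (x̂ (E p) +ₚ E p)

  iter : ℕ → (Poly → Poly) → Poly → Poly
  iter zero    f p = p
  iter (suc n) f p = f (iter n f p)

  falling : ℕ → Poly
  falling zero    = 1# ∷ []
  falling (suc n) = x̂ (falling n) +ₚ ((- (n × 1#)) ·ₚ falling n)

  φ-from : ℕ → Poly → Poly
  φ-from k []      = []
  φ-from k (a ∷ p) = (a ·ₚ falling k) +ₚ φ-from (suc k) p

  φ : Poly → Poly
  φ = φ-from 0

  sumₚ : ℕ → (ℕ → Poly) → Poly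
  sumₚ zero    f = f 0
  sumₚ (suc n) f = sumₚ n f +ₚ f (suc n)

  ⟦_⟧ : ℕ → Carrier
  ⟦ n ⟧ = n × 1#

module Submission where

-- Writing a polynomial as a + x·f, the recurrence (x)ₙ₊₁ = x·(x − 1)ₙ gives
-- φ(a + x·f) = a + x·E⁻¹(φ f), so φ is injective and φ⁻¹ x̂ = x̂ φ⁻¹ E.
-- Since E^k x̂ = (x̂ + k) E^k, applying the identity for n to x̂ p turns
-- S(n,k) x̂^k φ⁻¹ E^k into S(n,k) (x̂^(k+1) φ⁻¹ E^(k+1) + k x̂^k φ⁻¹ E^k),
-- and S(n+1,k) = k S(n,k) + S(n,k−1) regroups the sum into the identity for n + 1.
-- Because φ⁻¹ is an arbitrary function on coefficient lists, its compatibility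
-- with ≈ₚ and its linearity are themselves derived from the injectivity of φ.

open import Level using (_⊔_)
open import Data.Nat using (ℕ; zero; suc; _<_; s≤s)
import Data.Nat as ℕ
open import Data.Nat.Properties using (m≤n⇒m≤1+n; *-zeroʳ; n<1+n)
open import Data.List using ([]; _∷_)
open import Data.Product using (_,_)
open import Function using (_∘_)
open import Relation.Binary.PropositionalEquality as ≡ using (_≡_)
open import Relation.Binary.Bundles using (Setoid)
open import Algebra.Bundles using (CommutativeRing; CommutativeMonoid)
import Algebra.Properties.CommutativeSemigroup as CommutativeSemigroupProperties
import Algebra.Properties.Ring as RingProperties
import Algebra.Properties.Semiring.Mult as SemiringMultProperties
import Relation.Binary.Reasoning.Setoid as SetoidReasoning
open import Defs

S₂-above-diagonal : ∀ {n k} → n < k → S₂ n k ≡ 0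
S₂-above-diagonal {zero}  {suc k} _ = ≡.refl
S₂-above-diagonal {suc n} {suc k} (s≤s n<k)
  rewrite S₂-above-diagonal {n} {suc k} (m≤n⇒m≤1+n n<k) | S₂-above-diagonal n<k
  = ≡.cong (ℕ._+ 0) (*-zeroʳ (suc k))

module PolynomialOperators {c ℓ} (R : CommutativeRing c ℓ) where
  open CommutativeRing R hiding (zero)
  open RingProperties ring using (-0#≈0#; -‿+-comm)
  open SemiringMultProperties semiring using (×-homo-+; ×1-homo-*)
  open Polynomials R

  -- A record rather than a synonym for _≈ₚ_, so that p and q can be inferred from a proof.
  infix 4 _≋_
  record _≋_ (p q : Poly) : Set ℓ where
    constructor ≈ₚ⇒≋
    field ≋⇒≈ₚ : p ≈ₚ q
  open _≋_ public

  ≋-refl : ∀ {p} → p ≋ p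
  ≋-refl = ≈ₚ⇒≋ λ _ → refl

  ≋-sym : ∀ {p q} → p ≋ q → q ≋ p
  ≋-sym (≈ₚ⇒≋ h) = ≈ₚ⇒≋ λ i → sym (h i)

  ≋-trans : ∀ {p q r} → p ≋ q → q ≋ r → p ≋ r
  ≋-trans (≈ₚ⇒≋ h) (≈ₚ⇒≋ g) = ≈ₚ⇒≋ λ i → trans (h i) (g i)

  ≋-setoid : Setoid c ℓ
  ≋-setoid = record
    { _≈_ = _≋_
    ; isEquivalence = record { refl = ≋-refl ; sym = ≋-sym ; trans = ≋-trans }
    }

  [_] : Carrier → Poly
  [ a ] = a ∷ []

  ∷-cong : ∀ {a b p q} → a ≈ b → p ≋ q → a ∷ p ≋ b ∷ q
  ∷-cong a≈b (≈ₚ⇒≋ h) = ≈ₚ⇒≋ λ { zero → a≈b ; (suc i) → h i }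

  ∷-injectiveˡ : ∀ {a b p q} → a ∷ p ≋ b ∷ q → a ≈ b
  ∷-injectiveˡ (≈ₚ⇒≋ h) = h zero

  ∷-injectiveʳ : ∀ {a b p q} → a ∷ p ≋ b ∷ q → p ≋ q
  ∷-injectiveʳ (≈ₚ⇒≋ h) = ≈ₚ⇒≋ (h ∘ suc)

  [0#]≋[] : [ 0# ] ≋ []
  [0#]≋[] = ≈ₚ⇒≋ λ { zero → refl ; (suc i) → refl }

  coeff-+ₚ : ∀ p q i → coeff (p +ₚ q) i ≈ coeff p i + coeff q i
  coeff-+ₚ []      q       i       = sym (+-identityˡ _)
  coeff-+ₚ (a ∷ p) []      i       = sym (+-identityʳ _)
  coeff-+ₚ (a ∷ p) (b ∷ q) zero    = refl
  coeff-+ₚ (a ∷ p) (b ∷ q) (suc i) = coeff-+ₚ p q i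

  coeff-·ₚ : ∀ a p i → coeff (a ·ₚ p) i ≈ a * coeff p i
  coeff-·ₚ a []      i       = sym (zeroʳ a)
  coeff-·ₚ a (b ∷ p) zero    = refl
  coeff-·ₚ a (b ∷ p) (suc i) = coeff-·ₚ a p i

  +ₚ-cong : ∀ {p p′ q q′} → p ≋ p′ → q ≋ q′ → p +ₚ q ≋ p′ +ₚ q′
  +ₚ-cong {p} {p′} {q} {q′} (≈ₚ⇒≋ h) (≈ₚ⇒≋ g) = ≈ₚ⇒≋ λ i →
    trans (coeff-+ₚ p q i) (trans (+-cong (h i) (g i)) (sym (coeff-+ₚ p′ q′ i)))

  ·ₚ-cong : ∀ {a a′ p p′} → a ≈ a′ → p ≋ p′ → a ·ₚ p ≋ a′ ·ₚ p′
  ·ₚ-cong {a} {a′} {p} {p′} a≈a′ (≈ₚ⇒≋ h) = ≈ₚ⇒≋ λ i →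
    trans (coeff-·ₚ a p i) (trans (*-cong a≈a′ (h i)) (sym (coeff-·ₚ a′ p′ i)))

  +ₚ-assoc : ∀ p q r → (p +ₚ q) +ₚ r ≋ p +ₚ (q +ₚ r)
  +ₚ-assoc p q r = ≈ₚ⇒≋ λ i → begin
    coeff ((p +ₚ q) +ₚ r) i              ≈⟨ trans (coeff-+ₚ (p +ₚ q) r i) (+-congʳ (coeff-+ₚ p q i)) ⟩
    (coeff p i + coeff q i) + coeff r i  ≈⟨ +-assoc _ _ _ ⟩
    coeff p i + (coeff q i + coeff r i)  ≈⟨ trans (coeff-+ₚ p (q +ₚ r) i) (+-congˡ (coeff-+ₚ q r i)) ⟨
    coeff (p +ₚ (q +ₚ r)) i              ∎
    where open SetoidReasoning setoid

  +ₚ-comm : ∀ p q → p +ₚ q ≋ q +ₚ p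
  +ₚ-comm p q = ≈ₚ⇒≋ λ i →
    trans (coeff-+ₚ p q i) (trans (+-comm _ _) (sym (coeff-+ₚ q p i)))

  +ₚ-identityʳ : ∀ p → p +ₚ [] ≋ p
  +ₚ-identityʳ []      = ≋-refl
  +ₚ-identityʳ (a ∷ p) = ≋-refl

  +ₚ-commutativeMonoid : CommutativeMonoid c ℓ
  +ₚ-commutativeMonoid = record
    { _≈_ = _≋_
    ; _∙_ = _+ₚ_
    ; ε   = []
    ; isCommutativeMonoid = record
      { isMonoid = record
        { isSemigroup = record
          { isMagma = record
            { isEquivalence = Setoid.isEquivalence ≋-setoid
            ; ∙-cong = +ₚ-cong
            }
          ; assoc = +ₚ-assoc
          }
        ; identity = (λ _ → ≋-refl) , +ₚ-identityʳ
        }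
      ; comm = +ₚ-comm
      }
    }

  open CommutativeSemigroupProperties (CommutativeMonoid.commutativeSemigroup +ₚ-commutativeMonoid)
    using () renaming (interchange to +ₚ-interchange)

  ·ₚ-distribˡ : ∀ a p q → a ·ₚ (p +ₚ q) ≋ a ·ₚ p +ₚ a ·ₚ q
  ·ₚ-distribˡ a p q = ≈ₚ⇒≋ λ i → begin
    coeff (a ·ₚ (p +ₚ q)) i
      ≈⟨ trans (coeff-·ₚ a (p +ₚ q) i) (*-congˡ (coeff-+ₚ p q i)) ⟩
    a * (coeff p i + coeff q i)
      ≈⟨ distribˡ a _ _ ⟩
    a * coeff p i + a * coeff q i
      ≈⟨ trans (coeff-+ₚ (a ·ₚ p) (a ·ₚ q) i) (+-cong (coeff-·ₚ a p i) (coeff-·ₚ a q i)) ⟨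
    coeff (a ·ₚ p +ₚ a ·ₚ q) i ∎
    where open SetoidReasoning setoid

  ·ₚ-distribʳ : ∀ a b p → (a + b) ·ₚ p ≋ a ·ₚ p +ₚ b ·ₚ p
  ·ₚ-distribʳ a b p = ≈ₚ⇒≋ λ i → begin
    coeff ((a + b) ·ₚ p) i
      ≈⟨ coeff-·ₚ (a + b) p i ⟩
    (a + b) * coeff p i
      ≈⟨ distribʳ _ a b ⟩
    a * coeff p i + b * coeff p i
      ≈⟨ trans (coeff-+ₚ (a ·ₚ p) (b ·ₚ p) i) (+-cong (coeff-·ₚ a p i) (coeff-·ₚ b p i)) ⟨
    coeff (a ·ₚ p +ₚ b ·ₚ p) i ∎
    where open SetoidReasoning setoid

  ·ₚ-assoc : ∀ a b p → (a * b) ·ₚ p ≋ a ·ₚ (b ·ₚ p)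
  ·ₚ-assoc a b p = ≈ₚ⇒≋ λ i → begin
    coeff ((a * b) ·ₚ p) i  ≈⟨ coeff-·ₚ (a * b) p i ⟩
    (a * b) * coeff p i     ≈⟨ *-assoc a b _ ⟩
    a * (b * coeff p i)     ≈⟨ trans (coeff-·ₚ a (b ·ₚ p) i) (*-congˡ (coeff-·ₚ b p i)) ⟨
    coeff (a ·ₚ (b ·ₚ p)) i ∎
    where open SetoidReasoning setoid

  ·ₚ-comm : ∀ a b p → a ·ₚ (b ·ₚ p) ≋ b ·ₚ (a ·ₚ p)
  ·ₚ-comm a b p =
    ≋-trans (≋-sym (·ₚ-assoc a b p)) (≋-trans (·ₚ-cong (*-comm a b) ≋-refl) (·ₚ-assoc b a p))

  ·ₚ-identityˡ : ∀ p → 1# ·ₚ p ≋ p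
  ·ₚ-identityˡ p = ≈ₚ⇒≋ λ i → trans (coeff-·ₚ 1# p i) (*-identityˡ _)

  ·ₚ-zeroˡ : ∀ {a} p → a ≈ 0# → a ·ₚ p ≋ []
  ·ₚ-zeroˡ {a} p a≈0 = ≈ₚ⇒≋ λ i → trans (coeff-·ₚ a p i) (trans (*-congʳ a≈0) (zeroˡ _))

  ∷-split : ∀ a p → a ∷ p ≋ [ a ] +ₚ x̂ p
  ∷-split a p = ∷-cong (sym (+-identityʳ a)) ≋-refl

  record IsLinear (F : Poly → Poly) : Set (c ⊔ ℓ) where
    field
      cong    : ∀ {p q} → p ≋ q → F p ≋ F q
      +ₚ-homo : ∀ p q → F (p +ₚ q) ≋ F p +ₚ F q
      ·ₚ-homo : ∀ a p → F (a ·ₚ p) ≋ a ·ₚ F p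

    []-homo : F [] ≋ []
    []-homo = ≋-trans (·ₚ-homo 0# []) (·ₚ-zeroˡ (F []) refl)

    +ₚ-·ₚ-homo : ∀ p a q → F (p +ₚ a ·ₚ q) ≋ F p +ₚ a ·ₚ F q
    +ₚ-·ₚ-homo p a q = ≋-trans (+ₚ-homo p (a ·ₚ q)) (+ₚ-cong ≋-refl (·ₚ-homo a q))

  ∘-isLinear : ∀ {F G} → IsLinear F → IsLinear G → IsLinear (F ∘ G)
  ∘-isLinear F G = record
    { cong    = F.cong ∘ G.cong
    ; +ₚ-homo = λ p q → ≋-trans (F.cong (G.+ₚ-homo p q)) (F.+ₚ-homo _ _)
    ; ·ₚ-homo = λ a p → ≋-trans (F.cong (G.·ₚ-homo a p)) (F.·ₚ-homo a _)
    }
    where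
    module F = IsLinear F
    module G = IsLinear G

  iter-isLinear : ∀ {F} → IsLinear F → ∀ k → IsLinear (iter k F)
  iter-isLinear F zero    = record { cong = λ h → h ; +ₚ-homo = λ _ _ → ≋-refl ; ·ₚ-homo = λ _ _ → ≋-refl }
  iter-isLinear F (suc k) = ∘-isLinear F (iter-isLinear F k)

  iter-commute : ∀ k (F : Poly → Poly) p → iter k F (F p) ≡ F (iter k F p)
  iter-commute zero    F p = ≡.refl
  iter-commute (suc k) F p = ≡.cong F (iter-commute k F p)

  x̂-isLinear : IsLinear x̂
  x̂-isLinear = record
    { cong    = ∷-cong refl
    ; +ₚ-homo = λ _ _ → ∷-cong (sym (+-identityˡ 0#)) ≋-refl
    ; ·ₚ-homo = λ a _ → ∷-cong (sym (zeroʳ a)) ≋-refl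
    }

  x̂+_ : Carrier → Poly → Poly
  (x̂+ c) p = x̂ p +ₚ c ·ₚ p

  x̂+-isLinear : ∀ c → IsLinear (x̂+ c)
  x̂+-isLinear c = record
    { cong    = λ h → +ₚ-cong (x̂.cong h) (·ₚ-cong refl h)
    ; +ₚ-homo = λ p q → ≋-trans (+ₚ-cong (x̂.+ₚ-homo p q) (·ₚ-distribˡ c p q))
                                 (+ₚ-interchange (x̂ p) (x̂ q) (c ·ₚ p) (c ·ₚ q))
    ; ·ₚ-homo = λ a p → ≋-trans (+ₚ-cong (x̂.·ₚ-homo a p) (·ₚ-comm c a p))
                                 (≋-sym (·ₚ-distribˡ a (x̂ p) (c ·ₚ p)))
    }
    where module x̂ = IsLinear x̂-isLinear

  x̂+-zero : ∀ {c} p → c ≈ 0# → (x̂+ c) p ≋ x̂ p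
  x̂+-zero p c≈0 = ≋-trans (+ₚ-cong ≋-refl (·ₚ-zeroˡ p c≈0)) (+ₚ-identityʳ (x̂ p))

  module ConsRecursive {L : Poly → Poly} (L-isLinear : IsLinear L) {F : Poly → Poly}
      (F-[] : F [] ≋ []) (F-∷ : ∀ a p → F (a ∷ p) ≋ [ a ] +ₚ L (F p)) where
    private module L = IsLinear L-isLinear

    F-≋[] : ∀ {p} → p ≋ [] → F p ≋ []
    F-≋[] {[]}    _ = F-[]
    F-≋[] {a ∷ p} h = begin
      F (a ∷ p)         ≈⟨ F-∷ a p ⟩
      [ a ] +ₚ L (F p)  ≈⟨ +ₚ-cong (≋-trans (∷-cong (∷-injectiveˡ h′) ≋-refl) [0#]≋[])
                                   (L.cong (F-≋[] (∷-injectiveʳ h′))) ⟩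
      L []              ≈⟨ L.[]-homo ⟩
      []                ∎
      where open SetoidReasoning ≋-setoid
            h′ = ≋-trans h (≋-sym [0#]≋[])

    F-cong : ∀ {p q} → p ≋ q → F p ≋ F q
    F-cong {[]}    {q}     h = ≋-trans F-[] (≋-sym (F-≋[] (≋-sym h)))
    F-cong {a ∷ p} {[]}    h = ≋-trans (F-≋[] h) (≋-sym F-[])
    F-cong {a ∷ p} {b ∷ q} h = begin
      F (a ∷ p)         ≈⟨ F-∷ a p ⟩
      [ a ] +ₚ L (F p)  ≈⟨ +ₚ-cong (∷-cong (∷-injectiveˡ h) ≋-refl) (L.cong (F-cong (∷-injectiveʳ h))) ⟩
      [ b ] +ₚ L (F q)  ≈⟨ F-∷ b q ⟨
      F (b ∷ q)         ∎
      where open SetoidReasoning ≋-setoid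

    F-+ₚ : ∀ p q → F (p +ₚ q) ≋ F p +ₚ F q
    F-+ₚ []      q       = +ₚ-cong (≋-sym F-[]) ≋-refl
    F-+ₚ (a ∷ p) []      = ≋-sym (≋-trans (+ₚ-cong ≋-refl F-[]) (+ₚ-identityʳ _))
    F-+ₚ (a ∷ p) (b ∷ q) = begin
      F ((a + b) ∷ (p +ₚ q))
        ≈⟨ F-∷ (a + b) (p +ₚ q) ⟩
      ([ a ] +ₚ [ b ]) +ₚ L (F (p +ₚ q))
        ≈⟨ +ₚ-cong ≋-refl (≋-trans (L.cong (F-+ₚ p q)) (L.+ₚ-homo _ _)) ⟩
      ([ a ] +ₚ [ b ]) +ₚ (L (F p) +ₚ L (F q))
        ≈⟨ +ₚ-interchange [ a ] [ b ] (L (F p)) (L (F q)) ⟩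
      ([ a ] +ₚ L (F p)) +ₚ ([ b ] +ₚ L (F q))
        ≈⟨ +ₚ-cong (F-∷ a p) (F-∷ b q) ⟨
      F (a ∷ p) +ₚ F (b ∷ q) ∎
      where open SetoidReasoning ≋-setoid

    F-·ₚ : ∀ a p → F (a ·ₚ p) ≋ a ·ₚ F p
    F-·ₚ a []      = ≋-trans F-[] (≋-sym (·ₚ-cong refl F-[]))
    F-·ₚ a (b ∷ p) = begin
      F ((a * b) ∷ (a ·ₚ p))
        ≈⟨ F-∷ (a * b) (a ·ₚ p) ⟩
      a ·ₚ [ b ] +ₚ L (F (a ·ₚ p))
        ≈⟨ +ₚ-cong ≋-refl (≋-trans (L.cong (F-·ₚ a p)) (L.·ₚ-homo a (F p))) ⟩
      a ·ₚ [ b ] +ₚ a ·ₚ L (F p)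
        ≈⟨ ·ₚ-distribˡ a [ b ] (L (F p)) ⟨
      a ·ₚ ([ b ] +ₚ L (F p))
        ≈⟨ ·ₚ-cong refl (F-∷ b p) ⟨
      a ·ₚ F (b ∷ p) ∎
      where open SetoidReasoning ≋-setoid

    isLinear : IsLinear F
    isLinear = record { cong = F-cong ; +ₚ-homo = F-+ₚ ; ·ₚ-homo = F-·ₚ }

    F-x̂ : ∀ p → F (x̂ p) ≋ L (F p)
    F-x̂ p = ≋-trans (F-∷ 0# p) (+ₚ-cong [0#]≋[] ≋-refl)

    F-const : ∀ a → F [ a ] ≋ [ a ]
    F-const a = ≋-trans (F-∷ a []) (≋-trans (+ₚ-cong ≋-refl (≋-trans (L.cong F-[]) L.[]-homo))
                                            (+ₚ-identityʳ [ a ]))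

  shift : Carrier → Poly → Poly
  shift c []      = []
  shift c (a ∷ p) = [ a ] +ₚ (x̂+ c) (shift c p)

  shift-isLinear : ∀ c → IsLinear (shift c)
  shift-isLinear c = ConsRecursive.isLinear (x̂+-isLinear c) {shift c} ≋-refl (λ _ _ → ≋-refl)

  shift-x̂ : ∀ c p → shift c (x̂ p) ≋ (x̂+ c) (shift c p)
  shift-x̂ c = ConsRecursive.F-x̂ (x̂+-isLinear c) {shift c} ≋-refl (λ _ _ → ≋-refl)

  shift-const : ∀ c a → shift c [ a ] ≋ [ a ]
  shift-const c = ConsRecursive.F-const (x̂+-isLinear c) {shift c} ≋-refl (λ _ _ → ≋-refl)

  shift-x̂+ : ∀ {c d e} p → d + c ≈ e → shift d ((x̂+ c) p) ≋ (x̂+ e) (shift d p)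
  shift-x̂+ {c} {d} {e} p d+c≈e = begin
    shift d (x̂ p +ₚ c ·ₚ p)       ≈⟨ shift.+ₚ-·ₚ-homo (x̂ p) c p ⟩
    shift d (x̂ p) +ₚ c ·ₚ S       ≈⟨ +ₚ-cong (shift-x̂ d p) ≋-refl ⟩
    (x̂ S +ₚ d ·ₚ S) +ₚ c ·ₚ S     ≈⟨ +ₚ-assoc (x̂ S) (d ·ₚ S) (c ·ₚ S) ⟩
    x̂ S +ₚ (d ·ₚ S +ₚ c ·ₚ S)     ≈⟨ +ₚ-cong (≋-refl {x̂ S}) (·ₚ-distribʳ d c S) ⟨
    x̂ S +ₚ (d + c) ·ₚ S           ≈⟨ +ₚ-cong (≋-refl {x̂ S}) (·ₚ-cong d+c≈e (≋-refl {S})) ⟩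
    x̂ S +ₚ e ·ₚ S                 ∎
    where open SetoidReasoning ≋-setoid
          module shift = IsLinear (shift-isLinear d)
          S = shift d p

  shift-shift : ∀ {c d e} p → c + d ≈ e → shift c (shift d p) ≋ shift e p
  shift-shift         []      _       = ≋-refl
  shift-shift {c} {d} {e} (a ∷ p) c+d≈e = begin
    shift c ([ a ] +ₚ (x̂+ d) (shift d p))
      ≈⟨ IsLinear.+ₚ-homo (shift-isLinear c) [ a ] ((x̂+ d) (shift d p)) ⟩
    shift c [ a ] +ₚ shift c ((x̂+ d) (shift d p))
      ≈⟨ +ₚ-cong (shift-const c a) (shift-x̂+ (shift d p) c+d≈e) ⟩
    [ a ] +ₚ (x̂+ e) (shift c (shift d p))
      ≈⟨ +ₚ-cong (≋-refl {[ a ]}) (IsLinear.cong (x̂+-isLinear e) (shift-shift p c+d≈e)) ⟩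
    [ a ] +ₚ (x̂+ e) (shift e p) ∎
    where open SetoidReasoning ≋-setoid

  shift-zero : ∀ p → shift 0# p ≋ p
  shift-zero []      = ≋-refl
  shift-zero (a ∷ p) =
    ≋-trans (+ₚ-cong (≋-refl {[ a ]}) (≋-trans (x̂+-zero (shift 0# p) refl) (∷-cong refl (shift-zero p))))
            (≋-sym (∷-split a p))

  shift-inverse : ∀ {c d} p → c + d ≈ 0# → shift c (shift d p) ≋ p
  shift-inverse p c+d≈0 = ≋-trans (shift-shift p c+d≈0) (shift-zero p)

  shift-injective : ∀ {c p q} → shift c p ≋ shift c q → p ≋ q
  shift-injective {c} {p} {q} h = begin
    p                        ≈⟨ shift-inverse p (-‿inverseˡ c) ⟨
    shift (- c) (shift c p)  ≈⟨ IsLinear.cong (shift-isLinear (- c)) h ⟩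
    shift (- c) (shift c q)  ≈⟨ shift-inverse q (-‿inverseˡ c) ⟩
    q                        ∎
    where open SetoidReasoning ≋-setoid

  E≋shift : ∀ p → E p ≋ shift 1# p
  E≋shift []      = ≋-refl
  E≋shift (a ∷ p) =
    +ₚ-cong (≋-refl {[ a ]}) (+ₚ-cong (∷-cong refl IH) (≋-trans IH (≋-sym (·ₚ-identityˡ (shift 1# p)))))
    where IH = E≋shift p

  Eᵏ≋shift : ∀ k p → iter k E p ≋ shift ⟦ k ⟧ p
  Eᵏ≋shift zero    p = ≋-sym (shift-zero p)
  Eᵏ≋shift (suc k) p = ≋-trans (E≋shift (iter k E p))
    (≋-trans (IsLinear.cong (shift-isLinear 1#) (Eᵏ≋shift k p)) (shift-shift p refl))

  Eᵏ-x̂ : ∀ k p → iter k E (x̂ p) ≋ (x̂+ ⟦ k ⟧) (iter k E p)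
  Eᵏ-x̂ k p = ≋-trans (Eᵏ≋shift k (x̂ p)) (≋-trans (shift-x̂ ⟦ k ⟧ p)
                       (IsLinear.cong (x̂+-isLinear ⟦ k ⟧) (≋-sym (Eᵏ≋shift k p))))

  E⁻¹ : Poly → Poly
  E⁻¹ = shift (- 1#)

  E⁻¹-E : ∀ p → E⁻¹ (E p) ≋ p
  E⁻¹-E p = ≋-trans (IsLinear.cong (shift-isLinear (- 1#)) (E≋shift p)) (shift-inverse p (-‿inverseˡ 1#))

  falling-suc : ∀ n → falling (suc n) ≋ x̂ (E⁻¹ (falling n))
  falling-suc zero    = ≋-trans (x̂+-zero [ 1# ] -0#≈0#) (x̂.cong (≋-sym (shift-const (- 1#) 1#)))
    where module x̂ = IsLinear x̂-isLinear
  falling-suc (suc n) = begin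
    (x̂+ (- ⟦ suc n ⟧)) (falling (suc n))   ≈⟨ IsLinear.cong (x̂+-isLinear (- ⟦ suc n ⟧)) (falling-suc n) ⟩
    (x̂+ (- ⟦ suc n ⟧)) (x̂ G)               ≈⟨ x̂.+ₚ-·ₚ-homo (x̂ G) (- ⟦ suc n ⟧) G ⟨
    x̂ ((x̂+ (- ⟦ suc n ⟧)) G)               ≈⟨ x̂.cong (shift-x̂+ (falling n) (-‿+-comm 1# ⟦ n ⟧)) ⟨
    x̂ (E⁻¹ ((x̂+ (- ⟦ n ⟧)) (falling n)))   ∎
    where open SetoidReasoning ≋-setoid
          module x̂ = IsLinear x̂-isLinear
          G = E⁻¹ (falling n)

  x̂∘E⁻¹-isLinear : IsLinear (x̂ ∘ E⁻¹)
  x̂∘E⁻¹-isLinear = ∘-isLinear x̂-isLinear (shift-isLinear (- 1#))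

  φ-from-suc : ∀ k p → φ-from (suc k) p ≋ x̂ (E⁻¹ (φ-from k p))
  φ-from-suc k []      = ≋-sym [0#]≋[]
  φ-from-suc k (a ∷ p) = begin
    a ·ₚ falling (suc k) +ₚ φ-from (suc (suc k)) p
      ≈⟨ +ₚ-cong (·ₚ-cong refl (falling-suc k)) (φ-from-suc (suc k) p) ⟩
    a ·ₚ x̂ (E⁻¹ (falling k)) +ₚ x̂ (E⁻¹ (φ-from (suc k) p))
      ≈⟨ +ₚ-cong (M.·ₚ-homo a (falling k)) (≋-refl {x̂ (E⁻¹ (φ-from (suc k) p))}) ⟨
    x̂ (E⁻¹ (a ·ₚ falling k)) +ₚ x̂ (E⁻¹ (φ-from (suc k) p))
      ≈⟨ M.+ₚ-homo (a ·ₚ falling k) (φ-from (suc k) p) ⟨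
    x̂ (E⁻¹ (a ·ₚ falling k +ₚ φ-from (suc k) p)) ∎
    where open SetoidReasoning ≋-setoid
          module M = IsLinear x̂∘E⁻¹-isLinear

  φ-∷ : ∀ a p → φ (a ∷ p) ≋ a ∷ E⁻¹ (φ p)
  φ-∷ a p = ≋-trans (+ₚ-cong (∷-cong (*-identityʳ a) (≋-refl {[]})) (φ-from-suc 0 p))
                    (≋-sym (∷-split a (E⁻¹ (φ p))))

  φ-∷′ : ∀ a p → φ (a ∷ p) ≋ [ a ] +ₚ x̂ (E⁻¹ (φ p))
  φ-∷′ a p = ≋-trans (φ-∷ a p) (∷-split a (E⁻¹ (φ p)))

  φ-isLinear : IsLinear φ
  φ-isLinear = ConsRecursive.isLinear x̂∘E⁻¹-isLinear {φ} ≋-refl φ-∷′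

  φ-x̂ : ∀ p → φ (x̂ p) ≋ x̂ (E⁻¹ (φ p))
  φ-x̂ = ConsRecursive.F-x̂ x̂∘E⁻¹-isLinear {φ} ≋-refl φ-∷′

  φ-kernel : ∀ {p} → φ p ≋ [] → p ≋ []
  φ-kernel {[]}    _ = ≋-refl
  φ-kernel {a ∷ p} h =
    ≋-trans (∷-cong (∷-injectiveˡ h′) (φ-kernel (shift-injective {q = []} (∷-injectiveʳ h′)))) [0#]≋[]
    where h′ = ≋-trans (≋-sym (φ-∷ a p)) (≋-trans h (≋-sym [0#]≋[]))

  φ-injective : ∀ {p q} → φ p ≋ φ q → p ≋ q
  φ-injective {[]}    {q}     h = ≋-sym (φ-kernel (≋-sym h))
  φ-injective {a ∷ p} {[]}    h = φ-kernel h
  φ-injective {a ∷ p} {b ∷ q} h = ∷-cong (∷-injectiveˡ h′) (φ-injective (shift-injective (∷-injectiveʳ h′)))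
    where h′ = ≋-trans (≋-sym (φ-∷ a p)) (≋-trans h (φ-∷ b q))

  rightInverse-isLinear : ∀ {F G} → IsLinear F → (∀ {p q} → F p ≋ F q → p ≋ q) →
                          (∀ p → F (G p) ≋ p) → IsLinear G
  rightInverse-isLinear {F} {G} F-isLinear F-injective FG = record
    { cong    = λ {p} {q} p≋q → F-injective (≋-trans (FG p) (≋-trans p≋q (≋-sym (FG q))))
    ; +ₚ-homo = λ p q → F-injective (≋-trans (FG (p +ₚ q))
                          (≋-sym (≋-trans (F.+ₚ-homo (G p) (G q)) (+ₚ-cong (FG p) (FG q)))))
    ; ·ₚ-homo = λ a p → F-injective (≋-trans (FG (a ·ₚ p))
                          (≋-sym (≋-trans (F.·ₚ-homo a (G p)) (·ₚ-cong refl (FG p)))))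
    }
    where module F = IsLinear F-isLinear

  rightInverseOfφ-x̂ : ∀ (ψ : Poly → Poly) → (∀ p → φ (ψ p) ≋ p) → ∀ p → ψ (x̂ p) ≋ x̂ (ψ (E p))
  rightInverseOfφ-x̂ ψ φψ p = φ-injective (begin
    φ (ψ (x̂ p))             ≈⟨ φψ (x̂ p) ⟩
    x̂ p                     ≈⟨ x̂.cong (E⁻¹-E p) ⟨
    x̂ (E⁻¹ (E p))           ≈⟨ x̂.cong (IsLinear.cong (shift-isLinear (- 1#)) (φψ (E p))) ⟨
    x̂ (E⁻¹ (φ (ψ (E p))))   ≈⟨ φ-x̂ (ψ (E p)) ⟨
    φ (x̂ (ψ (E p)))         ∎)
    where open SetoidReasoning ≋-setoid
          module x̂ = IsLinear x̂-isLinear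

  sumₚ-cong : ∀ n {f g : ℕ → Poly} → (∀ k → f k ≋ g k) → sumₚ n f ≋ sumₚ n g
  sumₚ-cong zero    f≋g = f≋g 0
  sumₚ-cong (suc n) f≋g = +ₚ-cong (sumₚ-cong n f≋g) (f≋g (suc n))

  sumₚ-+ₚ : ∀ n (f g : ℕ → Poly) → sumₚ n (λ k → f k +ₚ g k) ≋ sumₚ n f +ₚ sumₚ n g
  sumₚ-+ₚ zero    f g = ≋-refl
  sumₚ-+ₚ (suc n) f g = ≋-trans (+ₚ-cong (sumₚ-+ₚ n f g) (≋-refl {f (suc n) +ₚ g (suc n)}))
                                (+ₚ-interchange (sumₚ n f) (sumₚ n g) (f (suc n)) (g (suc n)))

  sumₚ-dropHead : ∀ n (f : ℕ → Poly) → f 0 ≋ [] → sumₚ (suc n) f ≋ sumₚ n (f ∘ suc)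
  sumₚ-dropHead zero    f f0≋[] = +ₚ-cong f0≋[] (≋-refl {f 1})
  sumₚ-dropHead (suc n) f f0≋[] = +ₚ-cong (sumₚ-dropHead n f f0≋[]) (≋-refl {f (suc (suc n))})

  sumₚ-S₂-recurrence : ∀ n (A : ℕ → Poly) →
    sumₚ n (λ k → ⟦ S₂ n k ⟧ ·ₚ (A (suc k) +ₚ ⟦ k ⟧ ·ₚ A k))
      ≋ sumₚ (suc n) (λ k → ⟦ S₂ (suc n) k ⟧ ·ₚ A k)
  sumₚ-S₂-recurrence n A = begin
    sumₚ n (λ k → s k ·ₚ (A (suc k) +ₚ ⟦ k ⟧ ·ₚ A k))  ≈⟨ sumₚ-cong n split ⟩
    sumₚ n (λ k → C k +ₚ B k)                          ≈⟨ sumₚ-+ₚ n C B ⟩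
    sumₚ n C +ₚ sumₚ n B                               ≈⟨ +ₚ-comm (sumₚ n C) (sumₚ n B) ⟩
    sumₚ n B +ₚ sumₚ n C                               ≈⟨ +ₚ-cong reindexB (≋-refl {sumₚ n C}) ⟩
    sumₚ n (B ∘ suc) +ₚ sumₚ n C                       ≈⟨ sumₚ-+ₚ n (B ∘ suc) C ⟨
    sumₚ n (λ k → B (suc k) +ₚ C k)                    ≈⟨ sumₚ-cong n recurrence ⟨
    sumₚ n (T ∘ suc)                                   ≈⟨ sumₚ-dropHead n T (·ₚ-zeroˡ (A 0) refl) ⟨
    sumₚ (suc n) T                                     ∎
    where
    open SetoidReasoning ≋-setoid
    s : ℕ → Carrier
    s k = ⟦ S₂ n k ⟧
    B C T : ℕ → Poly
    B k = ⟦ k ⟧ ·ₚ (s k ·ₚ A k)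
    C k = s k ·ₚ A (suc k)
    T k = ⟦ S₂ (suc n) k ⟧ ·ₚ A k

    split : ∀ k → s k ·ₚ (A (suc k) +ₚ ⟦ k ⟧ ·ₚ A k) ≋ C k +ₚ B k
    split k = ≋-trans (·ₚ-distribˡ (s k) (A (suc k)) (⟦ k ⟧ ·ₚ A k))
                      (+ₚ-cong (≋-refl {C k}) (·ₚ-comm (s k) ⟦ k ⟧ (A k)))

    reindexB : sumₚ n B ≋ sumₚ n (B ∘ suc)
    reindexB = begin
      sumₚ n B             ≈⟨ +ₚ-identityʳ (sumₚ n B) ⟨
      sumₚ n B +ₚ []       ≈⟨ +ₚ-cong (≋-refl {sumₚ n B}) (·ₚ-cong {⟦ suc n ⟧} refl sₙ₊₁·A≋[]) ⟨
      sumₚ (suc n) B       ≈⟨ sumₚ-dropHead n B (·ₚ-zeroˡ (s 0 ·ₚ A 0) refl) ⟩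
      sumₚ n (B ∘ suc)     ∎
      where sₙ₊₁·A≋[] = ·ₚ-zeroˡ (A (suc n)) (reflexive (≡.cong ⟦_⟧ (S₂-above-diagonal (n<1+n n))))

    recurrence : ∀ k → T (suc k) ≋ B (suc k) +ₚ C k
    recurrence k = begin
      ⟦ suc k ℕ.* S₂ n (suc k) ℕ.+ S₂ n k ⟧ ·ₚ A (suc k)
        ≈⟨ ·ₚ-cong ⟦S₂⟧-recurrence (≋-refl {A (suc k)}) ⟩
      (⟦ suc k ⟧ * s (suc k) + s k) ·ₚ A (suc k)
        ≈⟨ ·ₚ-distribʳ (⟦ suc k ⟧ * s (suc k)) (s k) (A (suc k)) ⟩
      (⟦ suc k ⟧ * s (suc k)) ·ₚ A (suc k) +ₚ C k
        ≈⟨ +ₚ-cong (·ₚ-assoc ⟦ suc k ⟧ (s (suc k)) (A (suc k))) (≋-refl {C k}) ⟩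
      B (suc k) +ₚ C k ∎
      where ⟦S₂⟧-recurrence = trans (×-homo-+ 1# (suc k ℕ.* S₂ n (suc k)) (S₂ n k))
                                    (+-congʳ (×1-homo-* (suc k) (S₂ n (suc k))))

  module StirlingExpansion (ψ : Poly → Poly) (ψ-isLinear : IsLinear ψ)
      (ψ-x̂ : ∀ p → ψ (x̂ p) ≋ x̂ (ψ (E p))) where
    private module ψ = IsLinear ψ-isLinear

    x̂ᵏψEᵏ : ℕ → Poly → Poly
    x̂ᵏψEᵏ k p = iter k x̂ (ψ (iter k E p))

    x̂ᵏψEᵏ-x̂ : ∀ k p → x̂ᵏψEᵏ k (x̂ p) ≋ x̂ᵏψEᵏ (suc k) p +ₚ ⟦ k ⟧ ·ₚ x̂ᵏψEᵏ k p
    x̂ᵏψEᵏ-x̂ k p = begin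
      iter k x̂ (ψ (iter k E (x̂ p)))
        ≈⟨ x̂ᵏ.cong (ψ.cong (Eᵏ-x̂ k p)) ⟩
      iter k x̂ (ψ (x̂ Q +ₚ ⟦ k ⟧ ·ₚ Q))
        ≈⟨ x̂ᵏ.cong (ψ.+ₚ-·ₚ-homo (x̂ Q) ⟦ k ⟧ Q) ⟩
      iter k x̂ (ψ (x̂ Q) +ₚ ⟦ k ⟧ ·ₚ ψ Q)
        ≈⟨ x̂ᵏ.cong (+ₚ-cong (ψ-x̂ Q) (≋-refl {⟦ k ⟧ ·ₚ ψ Q})) ⟩
      iter k x̂ (x̂ (ψ (E Q)) +ₚ ⟦ k ⟧ ·ₚ ψ Q)
        ≈⟨ x̂ᵏ.+ₚ-·ₚ-homo (x̂ (ψ (E Q))) ⟦ k ⟧ (ψ Q) ⟩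
      iter k x̂ (x̂ (ψ (E Q))) +ₚ ⟦ k ⟧ ·ₚ x̂ᵏψEᵏ k p
        ≡⟨ ≡.cong (_+ₚ ⟦ k ⟧ ·ₚ x̂ᵏψEᵏ k p) (iter-commute k x̂ (ψ (E Q))) ⟩
      x̂ᵏψEᵏ (suc k) p +ₚ ⟦ k ⟧ ·ₚ x̂ᵏψEᵏ k p ∎
      where open SetoidReasoning ≋-setoid
            module x̂ᵏ = IsLinear (iter-isLinear x̂-isLinear k)
            Q = iter k E p

    ψ-x̂ⁿ : ∀ n p → ψ (iter n x̂ p) ≋ sumₚ n (λ k → ⟦ S₂ n k ⟧ ·ₚ x̂ᵏψEᵏ k p)
    ψ-x̂ⁿ zero    p = ≋-sym (≋-trans (·ₚ-cong (+-identityʳ 1#) (≋-refl {ψ p})) (·ₚ-identityˡ (ψ p)))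
    ψ-x̂ⁿ (suc n) p = begin
      ψ (iter (suc n) x̂ p)
        ≡⟨ ≡.cong ψ (iter-commute n x̂ p) ⟨
      ψ (iter n x̂ (x̂ p))
        ≈⟨ ψ-x̂ⁿ n (x̂ p) ⟩
      sumₚ n (λ k → ⟦ S₂ n k ⟧ ·ₚ x̂ᵏψEᵏ k (x̂ p))
        ≈⟨ sumₚ-cong n (λ k → ·ₚ-cong refl (x̂ᵏψEᵏ-x̂ k p)) ⟩
      sumₚ n (λ k → ⟦ S₂ n k ⟧ ·ₚ (x̂ᵏψEᵏ (suc k) p +ₚ ⟦ k ⟧ ·ₚ x̂ᵏψEᵏ k p))
        ≈⟨ sumₚ-S₂-recurrence n (λ k → x̂ᵏψEᵏ k p) ⟩
      sumₚ (suc n) (λ k → ⟦ S₂ (suc n) k ⟧ ·ₚ x̂ᵏψEᵏ k p) ∎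
      where open SetoidReasoning ≋-setoid

mainTheorem20 : ∀ {c ℓ} (K : CharZeroField c ℓ) →
    let open Polynomials (CharZeroField.ring K) in
    (φ⁻¹ : Poly → Poly) →
    (∀ p → φ⁻¹ (φ p) ≈ₚ p) → (∀ p → φ (φ⁻¹ p) ≈ₚ p) →
    ∀ (n : ℕ) (p : Poly) →
      φ⁻¹ (iter n x̂ p) ≈ₚ sumₚ n (λ k → ⟦ S₂ n k ⟧ ·ₚ iter k x̂ (φ⁻¹ (iter k E p)))
mainTheorem20 K φ⁻¹ _ φφ⁻¹ n p = ≋⇒≈ₚ (ψ-x̂ⁿ n p)
  where
  open Polynomials (CharZeroField.ring K)
  open PolynomialOperators (CharZeroField.ring K)
  φφ⁻¹≋ : ∀ q → φ (φ⁻¹ q) ≋ q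
  φφ⁻¹≋ q = ≈ₚ⇒≋ (φφ⁻¹ q)
  φ⁻¹-isLinear : IsLinear φ⁻¹
  φ⁻¹-isLinear = rightInverse-isLinear φ-isLinear φ-injective φφ⁻¹≋
  open StirlingExpansion φ⁻¹ φ⁻¹-isLinear (rightInverseOfφ-x̂ φ⁻¹ φφ⁻¹≋)
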